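{- Let $c$ be a proper edge coloring of $K_n$, let $k\ge1$ be an integer, and let $P$ be a maximal $k$-rainbow path. Then \[ |C_k(P)| \ge (k+1)n - (k+1)|V(P)|. \]
   Context: A proper edge coloring of $K_n=(V,E)$ is a map $c\colon E\to\mathbb{N}$ such that any two distinct edges sharing an endpoint receive different colors. A $k$-rainbow path is a path in which no color appears on more than $k$ of its edges. For a path $P$ and $i\ge1$, $C_i(P)$ is the set of colors used on exactly $i$ edges of $P$. For a $k$-rainbow path $P=(p_1,\dots,p_t)$, $C_A(P)=\{c(p_i,p_{i+1}) : 1\le i\le t-1,\ c(p_1,p_{i+1})\notin C_k(P)\}$, where $c(u,v)$ is the color of the edge $\{u,v\}$. Writing $V(P)^c=V\setminus V(P)$ and $c(v,S)$ for the set of colors of the edges $\{v,s\}$, $s\in S$, a $k$-rainbow path $P=(p_1,\dots,p_t)$ is called maximal if $c(p_1,V(P)^c)\subseteq C_k(P)$ and $c(p_t,V(P)^c)\subseteq C_k(P)\setminus C_A(P)$. -}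

module Defs where

open import Data.Nat using (ℕ; zero; suc; _+_; _*_; _∸_; _≤_)
open import Data.Nat.Properties using (_≟_)
open import Data.Fin using (Fin)
open import Data.List using (List; []; _∷_; length; map; filter; deduplicate)
open import Data.List.Membership.Propositional using (_∈_; _∉_)
open import Data.List.Relation.Unary.Unique.Propositional using (Unique)
open import Data.Product using (_×_; _,_; ∃-syntax)
open import Relation.Binary.PropositionalEquality using (_≡_; _≢_)
open import Relation.Nullary using (¬_; yes; no)

-- An edge colouring of K_n (vertex set Fin n): c u v is the colour of the edge {u,v}
-- (values on the diagonal c u u are irrelevant).
Coloring : ℕ → Set
Coloring n = Fin n → Fin n → ℕ

ProperColoring : ∀ {n} → Coloring n → Set
ProperColoring {n} c =
  (∀ u v → c u v ≡ c v u) ×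
  (∀ (u v w : Fin n) → u ≢ v → u ≢ w → v ≢ w → c u v ≢ c u w)

occ : ℕ → List ℕ → ℕ
occ x [] = 0
occ x (y ∷ ys) with x ≟ y
... | yes _ = suc (occ x ys)
... | no _  = occ x ys

-- A path P = (p₁, p₂, …, p_t) is given by its first vertex p₁ and the rest ps.
vertices : ∀ {n} → Fin n → List (Fin n) → List (Fin n)
vertices p₁ ps = p₁ ∷ ps

consecPairs : ∀ {n} → Fin n → List (Fin n) → List (Fin n × Fin n)
consecPairs a [] = []
consecPairs a (b ∷ bs) = (a , b) ∷ consecPairs b bs

lastV : ∀ {n} → Fin n → List (Fin n) → Fin n
lastV a [] = a
lastV a (b ∷ bs) = lastV b bs

edgeColors : ∀ {n} → Coloring n → Fin n → List (Fin n) → List ℕ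
edgeColors c p₁ ps = map (λ e → c (Data.Product.proj₁ e) (Data.Product.proj₂ e)) (consecPairs p₁ ps)

IsPath : ∀ {n} → Fin n → List (Fin n) → Set
IsPath p₁ ps = Unique (vertices p₁ ps)

IsRainbow : ∀ {n} → ℕ → Coloring n → Fin n → List (Fin n) → Set
IsRainbow k c p₁ ps = ∀ x → occ x (edgeColors c p₁ ps) ≤ k

InC : ∀ {n} → ℕ → Coloring n → Fin n → List (Fin n) → ℕ → Set
InC i c p₁ ps x = occ x (edgeColors c p₁ ps) ≡ i

Clist : ∀ {n} → ℕ → Coloring n → Fin n → List (Fin n) → List ℕ
Clist i c p₁ ps =
  deduplicate _≟_ (filter (λ x → occ x (edgeColors c p₁ ps) ≟ i) (edgeColors c p₁ ps))

cardC : ∀ {n} → ℕ → Coloring n → Fin n → List (Fin n) → ℕ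
cardC i c p₁ ps = length (Clist i c p₁ ps)

InCA : ∀ {n} → ℕ → Coloring n → Fin n → List (Fin n) → ℕ → Set
InCA {n} k c p₁ ps x =
  ∃[ a ] ∃[ b ] ((a , b) ∈ consecPairs p₁ ps × x ≡ c a b × ¬ InC k c p₁ ps (c p₁ b))

IsMaximal : ∀ {n} → ℕ → Coloring n → Fin n → List (Fin n) → Set
IsMaximal {n} k c p₁ ps =
  (∀ (v : Fin n) → v ∉ vertices p₁ ps → InC k c p₁ ps (c p₁ v)) ×
  (∀ (v : Fin n) → v ∉ vertices p₁ ps →
     InC k c p₁ ps (c (lastV p₁ ps) v) × ¬ InCA k c p₁ ps (c (lastV p₁ ps) v))

-- Let m = |V(P)ᶜ| and let N be the number of i with c(p₁, p_{i+1}) ∈ C_k(P). By properness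
-- the colours c(p₁, w), for w ∉ V(P) and for w one of these N vertices p_{i+1}, are pairwise
-- distinct, and they lie in C_k(P) (maximality at p₁), so |C_k(P)| ≥ N + m. At the other end,
-- the m colours c(p_t, v), v ∉ V(P), are distinct and lie in C_k(P) ∖ C_A(P): each is used on
-- exactly k edges (p_i, p_{i+1}) of P, and every one of them has c(p₁, p_{i+1}) ∈ C_k(P).
-- Hence km ≤ N, so |C_k(P)| ≥ (k+1)m ≥ (k+1)(n − |V(P)|).
module Submission where

open import Defs
open import Data.Nat using (ℕ; suc; _+_; _*_; _∸_; _≤_; _<_; z≤n; s≤s)
open import Data.Nat.Properties
  using (≤-reflexive; ≤-trans; ≤-<-trans; +-comm; +-suc; +-monoʳ-≤; +-monoˡ-≤; *-suc; *-zeroʳ;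
         *-monoʳ-≤; *-distribˡ-∸; m≤n+o⇒m∸n≤o; module ≤-Reasoning)
  renaming (_≟_ to _≟ℕ_)
open import Data.Fin using (Fin)
import Data.Fin as Fin
open import Data.Empty using (⊥-elim)
open import Data.Product using (_,_; proj₁; proj₂; _×_)
open import Data.Sum using (inj₁; inj₂)
open import Data.List using (List; []; _∷_; length; map; filter; _++_; allFin)
open import Data.List.Properties using (length-map; length-++; length-tabulate; filter-notAll)
open import Data.List.Membership.Propositional using (_∈_; _∉_)
open import Data.List.Membership.Propositional.Properties
  using (∈-map⁻; ∈-++⁺ˡ; ∈-++⁺ʳ; ∈-++⁻; ∈-filter⁺; ∈-filter⁻; ∈-allFin; ∈-deduplicate⁺)
import Data.List.Membership.DecPropositional as DecMembership
open import Data.List.Relation.Binary.Subset.Propositional using (_⊆_)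
open import Data.List.Relation.Unary.Any as Any using (here; there)
open import Data.List.Relation.Unary.All as All using (All)
import Data.List.Relation.Unary.All.Properties as All
open import Data.List.Relation.Unary.AllPairs using ([]; _∷_)
open import Data.List.Relation.Unary.Unique.Propositional using (Unique)
import Data.List.Relation.Unary.Unique.Propositional.Properties as Unique
open import Function using (_∘_)
open import Relation.Binary.Definitions using (DecidableEquality)
open import Relation.Binary.PropositionalEquality using (_≡_; _≢_; refl; sym; trans; cong)
open import Relation.Nullary using (¬_; yes; no; ¬?)
open import Relation.Unary using (Pred; Decidable)

module _ {A : Set} (_≟_ : DecidableEquality A) where

  Unique∧⊆⇒length≤ : ∀ {xs ys : List A} → Unique xs → xs ⊆ ys → length xs ≤ length ys
  Unique∧⊆⇒length≤ {[]} _ _ = z≤n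
  Unique∧⊆⇒length≤ {x ∷ xs} {ys} (x∉xs ∷ unique) x∷xs⊆ys =
    ≤-<-trans (Unique∧⊆⇒length≤ unique xs⊆others) others<ys
    where
    others : List A
    others = filter (λ y → ¬? (x ≟ y)) ys

    xs⊆others : xs ⊆ others
    xs⊆others z∈xs = ∈-filter⁺ (λ y → ¬? (x ≟ y)) (x∷xs⊆ys (there z∈xs)) (All.lookup x∉xs z∈xs)

    others<ys : length others < length ys
    others<ys = filter-notAll (λ y → ¬? (x ≟ y)) ys (Any.map (λ x≡y x≢y → x≢y x≡y) (x∷xs⊆ys (here refl)))

removeAll : ℕ → List ℕ → List ℕ
removeAll x [] = []
removeAll x (y ∷ ys) with x ≟ℕ y
... | yes _ = removeAll x ys
... | no _  = y ∷ removeAll x ys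

length≡occ+length-removeAll : ∀ x xs → length xs ≡ occ x xs + length (removeAll x xs)
length≡occ+length-removeAll x [] = refl
length≡occ+length-removeAll x (y ∷ xs) with x ≟ℕ y
... | yes _ = cong suc (length≡occ+length-removeAll x xs)
... | no _  = trans (cong suc (length≡occ+length-removeAll x xs)) (sym (+-suc _ _))

occ-removeAll : ∀ {x y} xs → y ≢ x → occ y (removeAll x xs) ≡ occ y xs
occ-removeAll [] _ = refl
occ-removeAll {x} {y} (z ∷ xs) y≢x with x ≟ℕ z
... | yes refl with y ≟ℕ x
...   | yes y≡x = ⊥-elim (y≢x y≡x)
...   | no _    = occ-removeAll xs y≢x
occ-removeAll {x} {y} (z ∷ xs) y≢x | no _ with y ≟ℕ z
...   | yes _ = cong suc (occ-removeAll xs y≢x)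
...   | no _  = occ-removeAll xs y≢x

occ≡k⇒k*length≤length : ∀ k {X} xs → Unique X → (∀ {x} → x ∈ X → occ x xs ≡ k) →
                         k * length X ≤ length xs
occ≡k⇒k*length≤length k {[]} xs _ _ = ≤-trans (≤-reflexive (*-zeroʳ k)) z≤n
occ≡k⇒k*length≤length k {x ∷ X} xs (x∉X ∷ unique) occ≡k = begin
  k * suc (length X)                  ≡⟨ *-suc k (length X) ⟩
  k + k * length X                    ≤⟨ +-monoʳ-≤ k (occ≡k⇒k*length≤length k (removeAll x xs) unique occ≡k′) ⟩
  k + length (removeAll x xs)         ≡⟨ cong (_+ length (removeAll x xs)) (occ≡k (here refl)) ⟨
  occ x xs + length (removeAll x xs)  ≡⟨ length≡occ+length-removeAll x xs ⟨
  length xs                           ∎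
  where
  open ≤-Reasoning
  occ≡k′ : ∀ {y} → y ∈ X → occ y (removeAll x xs) ≡ k
  occ≡k′ y∈X = trans (occ-removeAll xs (λ y≡x → All.lookup x∉X y∈X (sym y≡x))) (occ≡k (there y∈X))

occ-map-filter : ∀ {B : Set} {q} {Q : Pred B q} (Q? : Decidable Q) (f : B → ℕ) {x} es →
                 (∀ {e} → e ∈ es → f e ≡ x → Q e) → occ x (map f (filter Q? es)) ≡ occ x (map f es)
occ-map-filter Q? f [] _ = refl
occ-map-filter Q? f {x} (e ∷ es) only-Q with Q? e
... | yes _ with x ≟ℕ f e
...   | yes _ = cong suc (occ-map-filter Q? f es (only-Q ∘ there))
...   | no _  = occ-map-filter Q? f es (only-Q ∘ there)
occ-map-filter Q? f {x} (e ∷ es) only-Q | no ¬q with x ≟ℕ f e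
...   | yes x≡fe = ⊥-elim (¬q (only-Q (here refl) (sym x≡fe)))
...   | no _     = occ-map-filter Q? f es (only-Q ∘ there)

occ≡suc⇒∈ : ∀ {x k} xs → occ x xs ≡ suc k → x ∈ xs
occ≡suc⇒∈ {x} (y ∷ xs) occ≡ with x ≟ℕ y
... | yes refl = here refl
... | no _     = there (occ≡suc⇒∈ xs occ≡)

lastV∈vertices : ∀ {n} (a : Fin n) bs → lastV a bs ∈ vertices a bs
lastV∈vertices a [] = here refl
lastV∈vertices a (b ∷ bs) = there (lastV∈vertices b bs)

length-filter-consecPairs : ∀ {n q} {Q : Pred (Fin n) q} (Q? : Decidable Q) (a : Fin n) bs →
  length (filter (Q? ∘ proj₂) (consecPairs a bs)) ≡ length (filter Q? bs)
length-filter-consecPairs Q? a [] = refl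
length-filter-consecPairs Q? a (b ∷ bs) with Q? b
... | yes _ = cong suc (length-filter-consecPairs Q? b bs)
... | no _  = length-filter-consecPairs Q? b bs

module _ {n : ℕ} where
  open DecMembership (Fin._≟_ {n}) using (_∈?_; _∉?_)

  complement : List (Fin n) → List (Fin n)
  complement V = filter (_∉? V) (allFin n)

  ∈-complement⇒∉ : ∀ {V v} → v ∈ complement V → v ∉ V
  ∈-complement⇒∉ {V} = proj₂ ∘ ∈-filter⁻ (_∉? V) {xs = allFin n}

  n≤length+length-complement : ∀ V → n ≤ length V + length (complement V)
  n≤length+length-complement V = begin
    n                                ≡⟨ length-tabulate (λ v → v) ⟨
    length (allFin n)                ≤⟨ Unique∧⊆⇒length≤ Fin._≟_ (Unique.allFin⁺ n) allFin⊆ ⟩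
    length (V ++ complement V)       ≡⟨ length-++ V ⟩
    length V + length (complement V) ∎
    where
    open ≤-Reasoning
    allFin⊆ : allFin n ⊆ V ++ complement V
    allFin⊆ {v} _ with v ∈? V
    ... | yes v∈V = ∈-++⁺ˡ v∈V
    ... | no v∉V  = ∈-++⁺ʳ V (∈-filter⁺ (_∉? V) (∈-allFin v) v∉V)

proper⇒Unique-map : ∀ {n} {c : Coloring n} → ProperColoring c →
                    ∀ {u W} → u ∉ W → Unique W → Unique (map (c u) W)
proper⇒Unique-map _ {W = []} _ [] = []
proper⇒Unique-map pc@(_ , proper) {u} {w ∷ W} u∉w∷W (w∉W ∷ unique) =
  All.map⁺ (All.tabulate λ {y} y∈W →
    proper u w y (u∉w∷W ∘ here) (λ { refl → u∉w∷W (there y∈W) }) (All.lookup w∉W y∈W))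
  ∷ proper⇒Unique-map pc (u∉w∷W ∘ there) unique

InC⇒∈Clist : ∀ {n k x} (c : Coloring n) p₁ ps → 1 ≤ k → InC k c p₁ ps x → x ∈ Clist k c p₁ ps
InC⇒∈Clist {k = k} c p₁ ps (s≤s _) occ≡k =
  ∈-deduplicate⁺ _≟ℕ_ (∈-filter⁺ (λ y → occ y colours ≟ℕ k) (occ≡suc⇒∈ colours occ≡k) occ≡k)
  where
  colours : List ℕ
  colours = edgeColors c p₁ ps

module MaximalRainbowPath {n k : ℕ} (k≥1 : 1 ≤ k) (c : Coloring n) (proper : ProperColoring c)
  (p₁ : Fin n) (ps : List (Fin n)) (p₁∉ps : All (p₁ ≢_) ps) (unique-ps : Unique ps)
  (maximal : IsMaximal k c p₁ ps) where

  open ≤-Reasoning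

  outside : List (Fin n)
  outside = complement (vertices p₁ ps)

  unique-outside : Unique outside
  unique-outside = Unique.filter⁺ _ (Unique.allFin⁺ n)

  InCₖ-from-p₁ : Fin n → Set
  InCₖ-from-p₁ b = InC k c p₁ ps (c p₁ b)

  InCₖ-from-p₁? : Decidable InCₖ-from-p₁
  InCₖ-from-p₁? b = occ (c p₁ b) (edgeColors c p₁ ps) ≟ℕ k

  front : List (Fin n)
  front = filter InCₖ-from-p₁? ps

  front+outside≤cardC : length front + length outside ≤ cardC k c p₁ ps
  front+outside≤cardC = begin
    length front + length outside       ≡⟨ length-++ front ⟨
    length (front ++ outside)           ≡⟨ length-map (c p₁) (front ++ outside) ⟨
    length (map (c p₁) (front ++ outside))
      ≤⟨ Unique∧⊆⇒length≤ _≟ℕ_ (proper⇒Unique-map proper p₁∉ unique) colours⊆Cₖ ⟩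
    cardC k c p₁ ps                     ∎
    where
    unique : Unique (front ++ outside)
    unique = Unique.++⁺ (Unique.filter⁺ InCₖ-from-p₁? unique-ps) unique-outside
      λ (v∈front , v∈outside) →
        ∈-complement⇒∉ v∈outside (there (proj₁ (∈-filter⁻ InCₖ-from-p₁? {xs = ps} v∈front)))

    p₁∉ : p₁ ∉ front ++ outside
    p₁∉ p₁∈ with ∈-++⁻ front p₁∈
    ... | inj₁ p₁∈front   = All.lookup p₁∉ps (proj₁ (∈-filter⁻ InCₖ-from-p₁? {xs = ps} p₁∈front)) refl
    ... | inj₂ p₁∈outside = ∈-complement⇒∉ p₁∈outside (here refl)

    colours⊆Cₖ : map (c p₁) (front ++ outside) ⊆ Clist k c p₁ ps
    colours⊆Cₖ x∈ with ∈-map⁻ (c p₁) x∈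
    ... | w , w∈ , refl with ∈-++⁻ front w∈
    ...   | inj₁ w∈front   = InC⇒∈Clist c p₁ ps k≥1 (proj₂ (∈-filter⁻ InCₖ-from-p₁? {xs = ps} w∈front))
    ...   | inj₂ w∈outside = InC⇒∈Clist c p₁ ps k≥1 (proj₁ maximal w (∈-complement⇒∉ w∈outside))

  k*outside≤front : k * length outside ≤ length front
  k*outside≤front = begin
    k * length outside                       ≡⟨ cong (k *_) (length-map (c pₜ) outside) ⟨
    k * length (map (c pₜ) outside)          ≤⟨ occ≡k⇒k*length≤length k (map colour front-edges) unique occ≡k ⟩
    length (map colour front-edges)          ≡⟨ length-map colour front-edges ⟩
    length front-edges                       ≡⟨ length-filter-consecPairs InCₖ-from-p₁? p₁ ps ⟩
    length front                             ∎
    where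
    pₜ : Fin n
    pₜ = lastV p₁ ps

    colour : Fin n × Fin n → ℕ
    colour (a , b) = c a b

    front-edges : List (Fin n × Fin n)
    front-edges = filter (InCₖ-from-p₁? ∘ proj₂) (consecPairs p₁ ps)

    unique : Unique (map (c pₜ) outside)
    unique = proper⇒Unique-map proper (λ pₜ∈ → ∈-complement⇒∉ pₜ∈ (lastV∈vertices p₁ ps)) unique-outside

    occ≡k : ∀ {x} → x ∈ map (c pₜ) outside → occ x (map colour front-edges) ≡ k
    occ≡k x∈ with ∈-map⁻ (c pₜ) x∈
    ... | v , v∈outside , refl =
      trans (occ-map-filter (InCₖ-from-p₁? ∘ proj₂) colour (consecPairs p₁ ps) only-front) Cₖ
      where
      Cₖ : InC k c p₁ ps (c pₜ v)
      Cₖ = proj₁ (proj₂ maximal v (∈-complement⇒∉ v∈outside))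

      ¬A : ¬ InCA k c p₁ ps (c pₜ v)
      ¬A = proj₂ (proj₂ maximal v (∈-complement⇒∉ v∈outside))

      only-front : ∀ {e} → e ∈ consecPairs p₁ ps → colour e ≡ c pₜ v → InCₖ-from-p₁ (proj₂ e)
      only-front {a , b} e∈ colour≡ with InCₖ-from-p₁? b
      ... | yes front-b = front-b
      ... | no ¬front-b = ⊥-elim (¬A (a , b , e∈ , sym colour≡ , ¬front-b))

lemma4 : (n k : ℕ) → 1 ≤ k → (c : Coloring n) → ProperColoring c →
    (p₁ : Fin n) (ps : List (Fin n)) →
    IsPath p₁ ps → IsRainbow k c p₁ ps → IsMaximal k c p₁ ps →
    (suc k) * n ∸ (suc k) * length (vertices p₁ ps) ≤ cardC k c p₁ ps
-- The bound does not use that P is k-rainbow.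
lemma4 n k k≥1 c proper p₁ ps (p₁∉ps ∷ unique-ps) _ maximal = begin
  suc k * n ∸ suc k * t          ≡⟨ *-distribˡ-∸ (suc k) n t ⟨
  suc k * (n ∸ t)                ≤⟨ *-monoʳ-≤ (suc k) (m≤n+o⇒m∸n≤o n t (n≤length+length-complement V)) ⟩
  suc k * m                      ≡⟨ +-comm m (k * m) ⟩
  k * m + m                      ≤⟨ +-monoˡ-≤ m k*outside≤front ⟩
  length front + m               ≤⟨ front+outside≤cardC ⟩
  cardC k c p₁ ps                ∎
  where
  open ≤-Reasoning
  open MaximalRainbowPath k≥1 c proper p₁ ps p₁∉ps unique-ps maximal
  V : List (Fin n)
  V = vertices p₁ ps
  t m : ℕ
  t = length V
  m = length outside
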